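{- Let $n\ge 1$. The map $\alpha_n:\mathrm{Sym}(n+1)\times\mathbb{C}_n\to\mathbb{C}_n$ defined below is a (left) group action of $\mathrm{Sym}(n+1)$ on $\mathbb{C}_n$, i.e. $\alpha_n(\mathrm{id},\star)=\star$ and $\alpha_n(\sigma_1,\alpha_n(\sigma_2,\star))=\alpha_n(\sigma_1\cdot\sigma_2,\star)$ for all $\sigma_1,\sigma_2\in\mathrm{Sym}(n+1)$ and $\star\in\mathbb{C}_n$.
   Context: $\mathbb{N}^*=\mathbb{N}\setminus\{0\}$. $\mathbb{B}=\{+,-\}$ is the two-element group with identity $+$ (written multiplicatively; $-x$ means $(-)\cdot x$); the symbols $\forall,\exists$ also denote $+,-$ respectively. $\mathrm{Sym}(n+1)$ is the group of bijections of $\{1,\dots,n+1\}$ with product $\sigma\cdot\rho:=\rho\circ\sigma$; $(i\ j)$ denotes a transposition. Let $\mathbb{C}_n=\mathrm{Sym}(n+1)\times\mathbb{B}\times\mathbb{B}\times(\mathbb{N}^*)^{n+1}\times\mathbb{B}^n$, whose elements are written $(\sigma,\pm,\text{\AE},(k_1,\dots,k_{n+1}),(\pm_1,\dots,\pm_n))$. Define $\alpha_n(\rho,(\sigma,\pm,\text{\AE},(k_1,\dots,k_{n+1}),(\pm_1,\dots,\pm_n)))$ as follows. If $\rho(n+1)=n+1$, it is $(\rho\cdot\sigma,\pm,\text{\AE},(k_{\rho(1)},\dots,k_{\rho(n+1)}),(\pm_{\rho(1)},\dots,\pm_{\rho(n)}))$. If $\rho(n+1)\neq n+1$, put $\tau=(n+1\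 \rho(n+1))$ and $m=\rho^{ -1}(n+1)$; it is $(\rho\cdot\sigma,\,-\pm_{\rho(n+1)}\pm,\,-\pm_{\rho(n+1)}\text{\AE},\,(k_{\rho(1)},\dots,k_{\rho(n+1)}),\,(t_1,\dots,t_n))$ where $t_m=\pm_{\tau(\rho(m))}$ and $t_i=-\pm_{\rho(n+1)}\pm_{\tau(\rho(i))}$ for $i\neq m$. -}

module Defs where

open import Data.Nat using (ℕ; zero; suc; NonZero)
open import Data.Fin using (Fin; zero; suc; fromℕ; inject₁; _≟_)
open import Data.Fin.Permutation using (Permutation′; _⟨$⟩ʳ_; _∘ₚ_; transpose)
open import Data.Sign using (Sign; opposite) renaming (_*_ to _⊙_)
import Data.Sign
open import Data.Product using (Σ; _×_)
open import Relation.Nullary using (yes; no)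
open import Relation.Binary.PropositionalEquality using (_≡_)

-- 𝔹 = {+,-} is Data.Sign.Sign, identity + , product _⊙_ ; "-x" is opposite x.

ℕ* : Set
ℕ* = Σ ℕ NonZero

-- Sym(n+1) = permutations of Fin (suc n); the element "n+1" is  fromℕ n.
Sym : ℕ → Set
Sym n = Permutation′ (suc n)

-- product σ·ρ := ρ ∘ σ  (apply σ first, then ρ)
_·_ : ∀ {n} → Sym n → Sym n → Sym n
σ · ρ = σ ∘ₚ ρ

record ℂ (n : ℕ) : Set where
  constructor ⟨_,_,_,_,_⟩
  field
    perm  : Sym n
    sgn   : Sign
    ae    : Sign
    ks    : Fin (suc n) → ℕ*
    signs : Fin n → Sign
open ℂ public

_≈ℂ_ : ∀ {n} → ℂ n → ℂ n → Set
x ≈ℂ y = (∀ i → perm x ⟨$⟩ʳ i ≡ perm y ⟨$⟩ʳ i) × sgn x ≡ sgn y × ae x ≡ ae y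
         × (∀ i → ks x i ≡ ks y i) × (∀ i → signs x i ≡ signs y i)

-- extension of a sign vector (±_1,…,±_n) to indices 1..n+1; the value at
-- index n+1 is a junk value (+) that is never used by α.
ext : ∀ {n} → (Fin n → Sign) → Fin (suc n) → Sign
ext {zero}  s zero    = Data.Sign.Sign.+
ext {suc n} s zero    = s zero
ext {suc n} s (suc i) = ext (λ j → s (suc j)) i

top : ∀ n → Fin (suc n)
top n = fromℕ n

α : ∀ {n} → Sym n → ℂ n → ℂ n
α {n} ρ ⟨ σ , p , a , k , s ⟩ with (ρ ⟨$⟩ʳ top n) ≟ top n
... | yes _ = ⟨ ρ · σ , p , a , (λ i → k (ρ ⟨$⟩ʳ i)) , (λ i → ext s (ρ ⟨$⟩ʳ inject₁ i)) ⟩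
... | no  _ = ⟨ ρ · σ , c ⊙ p , c ⊙ a , (λ i → k (ρ ⟨$⟩ʳ i)) , t ⟩
  where
    r : Fin (suc n)
    r = ρ ⟨$⟩ʳ top n
    c : Sign
    c = opposite (ext s r)
    τ : Fin (suc n) → Fin (suc n)
    τ x = transpose (top n) r ⟨$⟩ʳ x
    t : Fin n → Sign
    t i with (ρ ⟨$⟩ʳ inject₁ i) ≟ top n
    ... | yes _ = ext s (τ (ρ ⟨$⟩ʳ inject₁ i))
    ... | no  _ = c ⊙ ext s (τ (ρ ⟨$⟩ʳ inject₁ i))

{-# OPTIONS --safe #-}
-- Write εᵢ = −±ᵢ for i ≤ n and ε_{n+1} = +.  In these coordinates αρ replaces ε
-- by the renormalised pull-back j ↦ ε_{ρ(j)} ε_{ρ(n+1)} and multiplies both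
-- global signs by ε_{ρ(n+1)}.  This is the permutation action of Sym(n+1) on
-- 𝔹^{n+1} twisted by renormalising at n+1, and its multiplier ε ↦ ε_{ρ(n+1)}
-- satisfies the cocycle identity, so the action axioms reduce to sign arithmetic.
module Submission where

open import Defs
open import Data.Nat using (ℕ; _≤_; zero; suc)
open import Data.Product using (_×_; _,_)
open import Data.Fin using (Fin; zero; suc; inject₁; _≟_)
open import Data.Fin.Properties using (fromℕ≢inject₁)
open import Data.Fin.Relation.Unary.Top using (view; ‵fromℕ; ‵inject₁)
open import Data.Fin.Permutation using (id; _⟨$⟩ʳ_; transpose)
open import Data.Sign using (Sign; +; -; opposite) renaming (_*_ to _⊙_)
open import Data.Sign.Properties
  using (opposite-involutive; s*s≡+; *-identityʳ; *-assoc; *-comm)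
open import Function using (_∘_; Injection)
open import Function.Properties.Inverse using (↔⇒↣)
open import Relation.Nullary using (yes; no; ¬_)
open import Data.Empty using (⊥-elim)
open import Relation.Binary.PropositionalEquality
open ≡-Reasoning

s*opposite[t]≡opposite[s*t] : ∀ s t → s ⊙ opposite t ≡ opposite (s ⊙ t)
s*opposite[t]≡opposite[s*t] + t = refl
s*opposite[t]≡opposite[s*t] - t = refl

[s*t]*[u*t]≡s*u : ∀ s t u → (s ⊙ t) ⊙ (u ⊙ t) ≡ s ⊙ u
[s*t]*[u*t]≡s*u s + u = cong₂ _⊙_ (*-identityʳ s) (*-identityʳ u)
[s*t]*[u*t]≡s*u + - + = refl
[s*t]*[u*t]≡s*u + - - = refl
[s*t]*[u*t]≡s*u - - + = refl
[s*t]*[u*t]≡s*u - - - = refl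

[s*t]*t≡s : ∀ s t → (s ⊙ t) ⊙ t ≡ s
[s*t]*t≡s s t = begin
  (s ⊙ t) ⊙ t  ≡⟨ *-assoc s t t ⟩
  s ⊙ (t ⊙ t)  ≡⟨ cong (s ⊙_) (s*s≡+ t) ⟩
  s ⊙ +        ≡⟨ *-identityʳ s ⟩
  s            ∎

module _ {n : ℕ} where

  perm-injective : (π : Sym n) {i j : Fin (suc n)} → π ⟨$⟩ʳ i ≡ π ⟨$⟩ʳ j → i ≡ j
  perm-injective π = Injection.injective (↔⇒↣ π)

  inject₁≢top : (i : Fin n) → ¬ inject₁ i ≡ top n
  inject₁≢top i = fromℕ≢inject₁ ∘ sym

  transpose-matchˡ : (i j : Fin (suc n)) → transpose i j ⟨$⟩ʳ i ≡ j
  transpose-matchˡ i j with i ≟ i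
  ... | yes _ = refl
  ... | no i≢i = ⊥-elim (i≢i refl)

  transpose-other : (i j k : Fin (suc n)) → ¬ k ≡ i → ¬ k ≡ j → transpose i j ⟨$⟩ʳ k ≡ k
  transpose-other i j k k≢i k≢j with k ≟ i
  ... | yes k≡i = ⊥-elim (k≢i k≡i)
  ... | no _ with k ≟ j
  ...   | yes k≡j = ⊥-elim (k≢j k≡j)
  ...   | no _ = refl

negExt : ∀ {n} → (Fin n → Sign) → Fin (suc n) → Sign
negExt {zero}  s zero    = +
negExt {suc n} s zero    = opposite (s zero)
negExt {suc n} s (suc j) = negExt (s ∘ suc) j

negExt-top : ∀ {n} (s : Fin n → Sign) → negExt s (top n) ≡ +
negExt-top {zero}  s = refl
negExt-top {suc n} s = negExt-top (s ∘ suc)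

negExt-inject₁ : ∀ {n} (s : Fin n → Sign) (i : Fin n) → negExt s (inject₁ i) ≡ opposite (s i)
negExt-inject₁ {suc n} s zero    = refl
negExt-inject₁ {suc n} s (suc i) = negExt-inject₁ (s ∘ suc) i

ext≡opposite-negExt : ∀ {n} (s : Fin n → Sign) {j} → ¬ j ≡ top n →
                      ext s j ≡ opposite (negExt s j)
ext≡opposite-negExt {zero}  s {zero}  j≢top = ⊥-elim (j≢top refl)
ext≡opposite-negExt {suc n} s {zero}  _     = sym (opposite-involutive (s zero))
ext≡opposite-negExt {suc n} s {suc j} j≢top = ext≡opposite-negExt (s ∘ suc) (j≢top ∘ cong suc)

module _ {n : ℕ} where

  twist : Sym n → (Fin (suc n) → Sign) → Sign
  twist ρ w = w (ρ ⟨$⟩ʳ top n)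

  infixr 5 _•_
  _•_ : Sym n → (Fin (suc n) → Sign) → Fin (suc n) → Sign
  (ρ • w) j = w (ρ ⟨$⟩ʳ j) ⊙ twist ρ w

  •-cong : (ρ : Sym n) {w v : Fin (suc n) → Sign} → (∀ j → w j ≡ v j) →
           ∀ j → (ρ • w) j ≡ (ρ • v) j
  •-cong ρ w≗v j = cong₂ _⊙_ (w≗v (ρ ⟨$⟩ʳ j)) (w≗v (ρ ⟨$⟩ʳ top n))

  •-identity : (w : Fin (suc n) → Sign) → w (top n) ≡ + → ∀ j → (id • w) j ≡ w j
  •-identity w w-top j = trans (cong (w j ⊙_) w-top) (*-identityʳ (w j))

  •-∘ : (σ₁ σ₂ : Sym n) (w : Fin (suc n) → Sign) →
        ∀ j → (σ₁ • σ₂ • w) j ≡ ((σ₁ · σ₂) • w) j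
  •-∘ σ₁ σ₂ w j =
    [s*t]*[u*t]≡s*u (w ((σ₁ · σ₂) ⟨$⟩ʳ j)) (twist σ₂ w) (twist (σ₁ · σ₂) w)

  twist-cocycle : (σ₁ σ₂ : Sym n) (w : Fin (suc n) → Sign) →
                  twist σ₁ (σ₂ • w) ⊙ twist σ₂ w ≡ twist (σ₁ · σ₂) w
  twist-cocycle σ₁ σ₂ w = [s*t]*t≡s (twist (σ₁ · σ₂) w) (twist σ₂ w)

coords : ∀ {n} → ℂ n → Fin (suc n) → Sign
coords x = negExt (signs x)

module _ {n : ℕ} (ρ : Sym n) (x : ℂ n) where

  private
    s = signs x
    w = coords x
    r = ρ ⟨$⟩ʳ top n

  α-perm : ∀ j → perm (α ρ x) ⟨$⟩ʳ j ≡ perm x ⟨$⟩ʳ (ρ ⟨$⟩ʳ j)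
  α-perm j with r ≟ top n
  ... | yes _ = refl
  ... | no _  = refl

  α-ks : ∀ j → ks (α ρ x) j ≡ ks x (ρ ⟨$⟩ʳ j)
  α-ks j with r ≟ top n
  ... | yes _ = refl
  ... | no _  = refl

  twist-fixed : r ≡ top n → twist ρ w ≡ +
  twist-fixed r≡top = trans (cong w r≡top) (negExt-top s)

  twist-moved : ¬ r ≡ top n → opposite (ext s r) ≡ twist ρ w
  twist-moved r≢top = trans (cong opposite (ext≡opposite-negExt s r≢top)) (opposite-involutive (w r))

  α-sgn : sgn (α ρ x) ≡ twist ρ w ⊙ sgn x
  α-sgn with r ≟ top n
  ... | yes r≡top = cong (_⊙ sgn x) (sym (twist-fixed r≡top))
  ... | no r≢top  = cong (_⊙ sgn x) (twist-moved r≢top)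

  α-ae : ae (α ρ x) ≡ twist ρ w ⊙ ae x
  α-ae with r ≟ top n
  ... | yes r≡top = cong (_⊙ ae x) (sym (twist-fixed r≡top))
  ... | no r≢top  = cong (_⊙ ae x) (twist-moved r≢top)

  α-signs : ∀ i → signs (α ρ x) i ≡ opposite ((ρ • w) (inject₁ i))
  α-signs i with r ≟ top n
  ... | yes r≡top = begin
    ext s q                   ≡⟨ ext≡opposite-negExt s q≢top ⟩
    opposite (w q)            ≡⟨ cong opposite (sym (*-identityʳ (w q))) ⟩
    opposite (w q ⊙ +)        ≡⟨ cong (λ c → opposite (w q ⊙ c)) (sym (twist-fixed r≡top)) ⟩
    opposite (w q ⊙ twist ρ w) ∎
    where
    q = ρ ⟨$⟩ʳ inject₁ i
    q≢top : ¬ q ≡ top n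
    q≢top q≡top = inject₁≢top i (perm-injective ρ (trans q≡top (sym r≡top)))
  ... | no r≢top with ρ ⟨$⟩ʳ inject₁ i ≟ top n
  ...   | yes q≡top = begin
    ext s (τ q)             ≡⟨ cong (ext s ∘ τ) q≡top ⟩
    ext s (τ (top n))       ≡⟨ cong (ext s) (transpose-matchˡ (top n) r) ⟩
    ext s r                 ≡⟨ ext≡opposite-negExt s r≢top ⟩
    opposite (+ ⊙ w r)      ≡⟨ cong (λ c → opposite (c ⊙ w r)) (sym wq≡+) ⟩
    opposite (w q ⊙ w r)    ∎
    where
    q = ρ ⟨$⟩ʳ inject₁ i
    τ = transpose (top n) r ⟨$⟩ʳ_
    wq≡+ : w q ≡ +
    wq≡+ = trans (cong w q≡top) (negExt-top s)
  ...   | no q≢top = begin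
    opposite (ext s r) ⊙ ext s (τ q) ≡⟨ cong₂ _⊙_ (twist-moved r≢top) (cong (ext s) τq≡q) ⟩
    w r ⊙ ext s q                    ≡⟨ cong (w r ⊙_) (ext≡opposite-negExt s q≢top) ⟩
    w r ⊙ opposite (w q)             ≡⟨ s*opposite[t]≡opposite[s*t] (w r) (w q) ⟩
    opposite (w r ⊙ w q)             ≡⟨ cong opposite (*-comm (w r) (w q)) ⟩
    opposite (w q ⊙ w r)             ∎
    where
    q = ρ ⟨$⟩ʳ inject₁ i
    τ = transpose (top n) r ⟨$⟩ʳ_
    τq≡q : τ q ≡ q
    τq≡q = transpose-other (top n) r q q≢top (inject₁≢top i ∘ perm-injective ρ)

  α-coords : ∀ j → coords (α ρ x) j ≡ (ρ • w) j
  α-coords j with view j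
  ... | ‵fromℕ     = trans (negExt-top (signs (α ρ x))) (sym (s*s≡+ (twist ρ w)))
  ... | ‵inject₁ i = begin
    negExt (signs (α ρ x)) (inject₁ i)   ≡⟨ negExt-inject₁ (signs (α ρ x)) i ⟩
    opposite (signs (α ρ x) i)           ≡⟨ cong opposite (α-signs i) ⟩
    opposite (opposite ((ρ • w) (inject₁ i))) ≡⟨ opposite-involutive _ ⟩
    (ρ • w) (inject₁ i)                  ∎

module _ {n : ℕ} where

  coords-injective : (x y : ℂ n) → (∀ j → coords x j ≡ coords y j) →
                     ∀ i → signs x i ≡ signs y i
  coords-injective x y x≗y i = begin
    signs x i                                ≡⟨ sym (opposite-involutive (signs x i)) ⟩
    opposite (opposite (signs x i))          ≡⟨ cong opposite (sym (negExt-inject₁ (signs x) i)) ⟩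
    opposite (coords x (inject₁ i))          ≡⟨ cong opposite (x≗y (inject₁ i)) ⟩
    opposite (coords y (inject₁ i))          ≡⟨ cong opposite (negExt-inject₁ (signs y) i) ⟩
    opposite (opposite (signs y i))          ≡⟨ opposite-involutive (signs y i) ⟩
    signs y i                                ∎

  module _ (f : ℂ n → Sign) (f-α : ∀ ρ x → f (α ρ x) ≡ twist ρ (coords x) ⊙ f x) where

    twisted-id : ∀ x → f (α id x) ≡ f x
    twisted-id x = trans (f-α id x) (cong (_⊙ f x) (negExt-top (signs x)))

    twisted-∘ : ∀ σ₁ σ₂ x → f (α σ₁ (α σ₂ x)) ≡ f (α (σ₁ · σ₂) x)
    twisted-∘ σ₁ σ₂ x = begin
      f (α σ₁ (α σ₂ x))                       ≡⟨ f-α σ₁ (α σ₂ x) ⟩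
      twist σ₁ (coords (α σ₂ x)) ⊙ f (α σ₂ x) ≡⟨ cong₂ _⊙_ (α-coords σ₂ x (σ₁ ⟨$⟩ʳ top n)) (f-α σ₂ x) ⟩
      c₁ ⊙ (c₂ ⊙ f x)                         ≡⟨ *-assoc c₁ c₂ (f x) ⟨
      (c₁ ⊙ c₂) ⊙ f x                         ≡⟨ cong (_⊙ f x) (twist-cocycle σ₁ σ₂ (coords x)) ⟩
      twist (σ₁ · σ₂) (coords x) ⊙ f x        ≡⟨ f-α (σ₁ · σ₂) x ⟨
      f (α (σ₁ · σ₂) x)                       ∎
      where
      c₁ = twist σ₁ (σ₂ • coords x)
      c₂ = twist σ₂ (coords x)

  α-id : (x : ℂ n) → α id x ≈ℂ x
  α-id x = α-perm id x , twisted-id sgn α-sgn x , twisted-id ae α-ae x , α-ks id x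
         , coords-injective (α id x) x coords-id
    where
    coords-id : ∀ j → coords (α id x) j ≡ coords x j
    coords-id j = trans (α-coords id x j) (•-identity (coords x) (negExt-top (signs x)) j)

  α-∘ : (σ₁ σ₂ : Sym n) (x : ℂ n) → α σ₁ (α σ₂ x) ≈ℂ α (σ₁ · σ₂) x
  α-∘ σ₁ σ₂ x = perm-∘ , twisted-∘ sgn α-sgn σ₁ σ₂ x , twisted-∘ ae α-ae σ₁ σ₂ x , ks-∘
              , coords-injective (α σ₁ y) (α (σ₁ · σ₂) x) coords-∘
    where
    y = α σ₂ x

    perm-∘ : ∀ j → perm (α σ₁ y) ⟨$⟩ʳ j ≡ perm (α (σ₁ · σ₂) x) ⟨$⟩ʳ j
    perm-∘ j = trans (α-perm σ₁ y j) (trans (α-perm σ₂ x (σ₁ ⟨$⟩ʳ j)) (sym (α-perm (σ₁ · σ₂) x j)))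

    ks-∘ : ∀ j → ks (α σ₁ y) j ≡ ks (α (σ₁ · σ₂) x) j
    ks-∘ j = trans (α-ks σ₁ y j) (trans (α-ks σ₂ x (σ₁ ⟨$⟩ʳ j)) (sym (α-ks (σ₁ · σ₂) x j)))

    coords-∘ : ∀ j → coords (α σ₁ y) j ≡ coords (α (σ₁ · σ₂) x) j
    coords-∘ j = begin
      coords (α σ₁ y) j          ≡⟨ α-coords σ₁ y j ⟩
      (σ₁ • coords y) j          ≡⟨ •-cong σ₁ (α-coords σ₂ x) j ⟩
      (σ₁ • σ₂ • coords x) j     ≡⟨ •-∘ σ₁ σ₂ (coords x) j ⟩
      ((σ₁ · σ₂) • coords x) j   ≡⟨ α-coords (σ₁ · σ₂) x j ⟨
      coords (α (σ₁ · σ₂) x) j   ∎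

mainTheorem1 : (n : ℕ) → 1 ≤ n →
    ((x : ℂ n) → α id x ≈ℂ x)
    × ((σ₁ σ₂ : Sym n) (x : ℂ n) → α σ₁ (α σ₂ x) ≈ℂ α (σ₁ · σ₂) x)
mainTheorem1 n _ = α-id , α-∘
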